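{- For every $E\in\mathcal{L}({\sf par})$, the unification type of classical propositional logic extended by the axiom $E$ is unitary: every formula $A$ unifiable in this logic has a unifier that is more general than every unifier of $A$ in this logic.
   Context: The language $\mathcal{L}$ is built from atoms ${\sf var}\cup{\sf par}$ (variables and parameters, disjoint infinite sets) using $\bot,\wedge,\vee,\to$. $\mathcal{L}({\sf par})$ is the set of formulas whose atoms are all parameters. A substitution is a map $\theta:\mathcal{L}\to\mathcal{L}$ commuting with connectives with $\theta(p)=p$ for $p\in{\sf par}$. The logic ${\sf CPC}+E$ is classical logic with the single extra axiom $E$ (not as a schema), so ${\sf CPC}+E\vdash C$ iff $E\to C$ is classically provable. A unifier of $A$ in this logic is a substitution $\theta$ with ${\sf CPC}+E\vdash\theta(A)$. $\gamma$ is less general than $\theta$ if there is a substitution $\lambda$ with ${\sf CPC}+E\vdash\gamma(x)\leftrightarrow\lambda(\theta(x))$ for every variable $x$. -}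

module Defs where

open import Data.Nat using (ℕ)
open import Data.Bool using (Bool; true; false; _∧_; _∨_; not)
open import Relation.Binary.PropositionalEquality using (_≡_)
open import Data.Product using (Σ; ∃; _×_)

data Fm : Set where
  var  : ℕ → Fm
  par  : ℕ → Fm
  ⊥'   : Fm
  _∧'_ : Fm → Fm → Fm
  _∨'_ : Fm → Fm → Fm
  _⇒_  : Fm → Fm → Fm

infixr 6 _∧'_
infixr 5 _∨'_
infixr 4 _⇒_

_⇔'_ : Fm → Fm → Fm
A ⇔' B = (A ⇒ B) ∧' (B ⇒ A)

data ParOnly : Fm → Set where
  par  : ∀ n → ParOnly (par n)
  ⊥'   : ParOnly ⊥'
  _∧'_ : ∀ {A B} → ParOnly A → ParOnly B → ParOnly (A ∧' B)
  _∨'_ : ∀ {A B} → ParOnly A → ParOnly B → ParOnly (A ∨' B)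
  _⇒_  : ∀ {A B} → ParOnly A → ParOnly B → ParOnly (A ⇒ B)

Subst : Set
Subst = ℕ → Fm

sub : Subst → Fm → Fm
sub θ (var n)  = θ n
sub θ (par n)  = par n
sub θ ⊥'       = ⊥'
sub θ (A ∧' B) = sub θ A ∧' sub θ B
sub θ (A ∨' B) = sub θ A ∨' sub θ B
sub θ (A ⇒ B)  = sub θ A ⇒ sub θ B

-- Classical (two-valued) semantics; CPC ⊢ C iff C is a tautology
-- (soundness and completeness of classical propositional logic).
eval : (ℕ → Bool) → (ℕ → Bool) → Fm → Bool
eval v p (var n)  = v n
eval v p (par n)  = p n
eval v p ⊥'       = false
eval v p (A ∧' B) = eval v p A ∧ eval v p B
eval v p (A ∨' B) = eval v p A ∨ eval v p B
eval v p (A ⇒ B)  = not (eval v p A) ∨ eval v p B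

CPC⊢ : Fm → Set
CPC⊢ C = (v p : ℕ → Bool) → eval v p C ≡ true

-- CPC + E ⊢ C  iff  CPC ⊢ E → C  (E a single extra axiom, not a schema).
_⊢_ : Fm → Fm → Set
E ⊢ C = CPC⊢ (E ⇒ C)

Unifier : Fm → Fm → Subst → Set
Unifier E A θ = E ⊢ sub θ A

Unifiable : Fm → Fm → Set
Unifiable E A = Σ Subst (Unifier E A)

LessGeneral : Fm → Subst → Subst → Set
LessGeneral E γ θ = ∃ λ (λs : Subst) → ∀ x → E ⊢ (γ x ⇔' sub λs (θ x))

Unitary : Fm → Set
Unitary E = ∀ A → Unifiable E A →
  ∃ λ θ → Unifier E A θ × (∀ γ → Unifier E A γ → LessGeneral E γ θ)

{-# OPTIONS --safe #-}
module Submission where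

open import Defs
open import Data.Nat using (ℕ)
open import Data.Bool using (Bool; true; false; _∧_; _∨_; not; if_then_else_)
open import Data.Bool.Properties using (∨-identityʳ; ∨-inverseˡ)
open import Data.Product using (_,_)
open import Relation.Binary.PropositionalEquality
  using (_≡_; refl; sym; cong; cong₂; subst; module ≡-Reasoning)

-- Löwenheim's argument.  If σ unifies A, put θ x = (A ∧ x) ∨ (¬A ∧ σ x).
-- Under a valuation making A true θ acts as the identity, under one making
-- A false it acts as σ; either way θ(A) holds wherever E does, so θ unifies A.
-- For any unifier γ, γ(A) holds wherever E does, and there γ(θ x) is
-- equivalent to γ x: every unifier γ is γ ∘ θ modulo E.

⊢-intro : ∀ {E C} → (∀ v p → eval v p E ≡ true → eval v p C ≡ true) → E ⊢ C
⊢-intro {E} h v p with eval v p E in eE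
... | false = refl
... | true  = h v p eE

⊢-elim : ∀ {E C} → E ⊢ C → ∀ v p → eval v p E ≡ true → eval v p C ≡ true
⊢-elim {E} {C} d v p eE = subst (λ e → not e ∨ eval v p C ≡ true) eE (d v p)

eval-⇔'-intro : ∀ {v p} B C → eval v p B ≡ eval v p C → eval v p (B ⇔' C) ≡ true
eval-⇔'-intro {v} {p} B C eq rewrite eq =
  cong₂ _∧_ (∨-inverseˡ (eval v p C)) (∨-inverseˡ (eval v p C))

eval-ext : ∀ {v w} p → (∀ n → v n ≡ w n) → ∀ B → eval v p B ≡ eval w p B
eval-ext p h (var n)  = h n
eval-ext p h (par n)  = refl
eval-ext p h ⊥'       = refl
eval-ext p h (A ∧' B) = cong₂ _∧_ (eval-ext p h A) (eval-ext p h B)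
eval-ext p h (A ∨' B) = cong₂ _∨_ (eval-ext p h A) (eval-ext p h B)
eval-ext p h (A ⇒ B)  = cong₂ (λ a b → not a ∨ b) (eval-ext p h A) (eval-ext p h B)

eval-sub : ∀ v p θ B → eval v p (sub θ B) ≡ eval (λ n → eval v p (θ n)) p B
eval-sub v p θ (var n)  = refl
eval-sub v p θ (par n)  = refl
eval-sub v p θ ⊥'       = refl
eval-sub v p θ (A ∧' B) = cong₂ _∧_ (eval-sub v p θ A) (eval-sub v p θ B)
eval-sub v p θ (A ∨' B) = cong₂ _∨_ (eval-sub v p θ A) (eval-sub v p θ B)
eval-sub v p θ (A ⇒ B)  = cong₂ (λ a b → not a ∨ b) (eval-sub v p θ A) (eval-sub v p θ B)

eval-if-valuation : ∀ b (v w : ℕ → Bool) p B →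
  eval (λ n → if b then v n else w n) p B ≡ (if b then eval v p B else eval w p B)
eval-if-valuation true  v w p B = refl
eval-if-valuation false v w p B = refl

if′_then_else_ : Fm → Fm → Fm → Fm
if′ A then B else C = (A ∧' B) ∨' ((A ⇒ ⊥') ∧' C)

eval-if′ : ∀ v p A B C →
  eval v p (if′ A then B else C) ≡ (if eval v p A then eval v p B else eval v p C)
eval-if′ v p A B C with eval v p A
... | true  = ∨-identityʳ (eval v p B)
... | false = refl

löwenheim : Fm → Subst → Subst
löwenheim A σ x = if′ A then var x else σ x

eval-löwenheim : ∀ v p A σ B →
  eval v p (sub (löwenheim A σ) B) ≡ (if eval v p A then eval v p B else eval v p (sub σ B))
eval-löwenheim v p A σ B = begin
  eval v p (sub (löwenheim A σ) B)
    ≡⟨ eval-sub v p (löwenheim A σ) B ⟩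
  eval (λ n → eval v p (löwenheim A σ n)) p B
    ≡⟨ eval-ext p (λ n → eval-if′ v p A (var n) (σ n)) B ⟩
  eval (λ n → if eval v p A then v n else eval v p (σ n)) p B
    ≡⟨ eval-if-valuation (eval v p A) v _ p B ⟩
  (if eval v p A then eval v p B else eval (λ n → eval v p (σ n)) p B)
    ≡⟨ cong (if eval v p A then eval v p B else_) (sym (eval-sub v p σ B)) ⟩
  (if eval v p A then eval v p B else eval v p (sub σ B))
    ∎
  where open ≡-Reasoning

löwenheim-unifier : ∀ E A σ → Unifier E A σ → Unifier E A (löwenheim A σ)
löwenheim-unifier E A σ u = ⊢-intro {E} {sub (löwenheim A σ) A} λ v p eE → begin
  eval v p (sub (löwenheim A σ) A)
    ≡⟨ eval-löwenheim v p A σ A ⟩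
  (if eval v p A then eval v p A else eval v p (sub σ A))
    ≡⟨ if-self (eval v p A) (⊢-elim {E} {sub σ A} u v p eE) ⟩
  true
    ∎
  where
  open ≡-Reasoning
  if-self : ∀ a {b} → b ≡ true → (if a then a else b) ≡ true
  if-self true  _  = refl
  if-self false eb = eb

löwenheim-most-general : ∀ E A σ γ → Unifier E A γ → LessGeneral E γ (löwenheim A σ)
löwenheim-most-general E A σ γ u = γ , λ x →
  ⊢-intro {E} {γ x ⇔' sub γ (löwenheim A σ x)} λ v p eE →
  eval-⇔'-intro (γ x) (sub γ (löwenheim A σ x)) (sym (begin
    eval v p (sub γ (löwenheim A σ x))
      ≡⟨ eval-if′ v p (sub γ A) (γ x) (sub γ (σ x)) ⟩
    (if eval v p (sub γ A) then eval v p (γ x) else eval v p (sub γ (σ x)))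
      ≡⟨ cong (if_then eval v p (γ x) else eval v p (sub γ (σ x)))
              (⊢-elim {E} {sub γ A} u v p eE) ⟩
    eval v p (γ x)
      ∎))
  where open ≡-Reasoning

unitary : ∀ E → Unitary E
unitary E A (σ , u) =
  löwenheim A σ , löwenheim-unifier E A σ u , löwenheim-most-general E A σ

-- The Löwenheim unifier never substitutes into E.
corollary3p6 : (E : Fm) → ParOnly E → Unitary E
corollary3p6 E _ = unitary E
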